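{- Let $k\ge 2$ be an integer, $\ell$ a positive integer and $p\in(0,1)$. If a realization of the graph $H(k,\ell,p)$ has maximum degree \[ \Delta(H(k,\ell,p)) < \frac{k\ell}{k-1} - 1, \] then $\theta(H(k,\ell,p)) = k$.
   Context: $\theta$ denotes the clique cover number: the least number of cliques whose vertex sets partition the vertex set. For positive integers $k,\ell$ and real $p\in(0,1)$, the random graph $H(k,\ell,p)$ has vertex set the union of $k$ pairwise disjoint sets $S_1,\dots,S_k$, each of cardinality $\ell$; each $S_i$ induces a clique; and for every pair $u\in S_i$, $v\in S_j$ with $i\neq j$, the edge $uv$ is present with probability $p$, independently of all other such pairs. -}

module Defs where

open import Data.Nat using (ℕ; _+_; _*_; _∸_; _<_)
open import Data.Fin using (Fin)
open import Data.Bool using (Bool; true; false; if_then_else_)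
open import Data.List using (List; map; allFin; cartesianProduct)
open import Data.Nat.ListAction using (sum)
open import Data.Product using (_×_; _,_; proj₁; Σ; ∃)
open import Relation.Binary.PropositionalEquality using (_≡_; _≢_)
open import Relation.Nullary using (¬_)
open import Function using (Surjective)

-- Vertex set of H(k,ℓ,p): S_1 ∪ … ∪ S_k with |S_i| = ℓ; vertex (i , j) is the
-- j-th element of S_i.
V : ℕ → ℕ → Set
V k ℓ = Fin k × Fin ℓ

-- A realization of H(k,ℓ,p) (p ∈ (0,1)): a simple graph on V k ℓ in which each
-- S_i induces a clique; the edges between distinct parts are arbitrary
-- (every such pattern has positive probability when 0 < p < 1).
record Realization (k ℓ : ℕ) : Set where
  field
    adj      : V k ℓ → V k ℓ → Bool
    adj-sym  : ∀ u v → adj u v ≡ adj v u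
    adj-irr  : ∀ v → adj v v ≡ false
    adj-part : ∀ u v → proj₁ u ≡ proj₁ v → u ≢ v → adj u v ≡ true
open Realization public

allV : (k ℓ : ℕ) → List (V k ℓ)
allV k ℓ = cartesianProduct (allFin k) (allFin ℓ)

degree : {k ℓ : ℕ} → Realization k ℓ → V k ℓ → ℕ
degree {k} {ℓ} H v = sum (map (λ u → if adj H v u then 1 else 0) (allV k ℓ))

-- A partition of the vertex set into m cliques: a surjective assignment of
-- vertices to m (hence nonempty) classes, each class inducing a clique.
IsCliqueCover : {k ℓ : ℕ} → Realization k ℓ → (m : ℕ) → (V k ℓ → Fin m) → Set
IsCliqueCover H m c =
  Surjective _≡_ _≡_ c ×
  (∀ u v → c u ≡ c v → u ≢ v → adj H u v ≡ true)

HasCliqueCover : {k ℓ : ℕ} → Realization k ℓ → ℕ → Set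
HasCliqueCover {k} {ℓ} H m = Σ (V k ℓ → Fin m) (IsCliqueCover H m)

CliqueCoverNumber≡ : {k ℓ : ℕ} → Realization k ℓ → ℕ → Set
CliqueCoverNumber≡ H t = HasCliqueCover H t × (∀ m → m < t → ¬ HasCliqueCover H m)

{-# OPTIONS --safe #-}
-- If m < k cliques partitioned the vertex set, some clique C would have at
-- least kℓ/m ≥ kℓ/(k-1) vertices.  Any v ∈ C is adjacent to all of C - v, so
-- deg v + 1 ≥ |C| ≥ kℓ/(k-1), contradicting the degree bound.  The k parts
-- S_1, …, S_k themselves form a clique cover.
module Submission where

open import Defs
open import Data.Bool using (Bool; true; if_then_else_)
open import Data.Empty using (⊥-elim)
open import Data.Fin as Fin using (Fin; fromℕ<) renaming (_≟_ to _≟ᶠ_)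
open import Data.Fin.Properties using (¬Fin0)
open import Data.List using (List; []; _∷_; map; allFin; tabulate; cartesianProduct; length)
open import Data.List.Properties using (length-map; length-++; length-tabulate)
open import Data.List.Membership.Propositional using (_∈_)
open import Data.List.Membership.Propositional.Properties using (∈-allFin)
open import Data.List.Relation.Unary.All using (All; []; _∷_)
open import Data.List.Relation.Unary.AllPairs using (_∷_)
open import Data.List.Relation.Unary.Any using (here; there)
open import Data.List.Relation.Unary.Unique.Propositional using (Unique)
open import Data.List.Relation.Unary.Unique.Propositional.Properties
  using (cartesianProduct⁺; allFin⁺)
open import Data.Nat using (ℕ; _+_; _*_; _∸_; _<_; _≤_; zero; suc; z≤n; s≤s; NonZero)
open import Data.Nat.ListAction using (sum)
open import Data.Nat.Properties
open import Algebra.Properties.CommutativeSemigroup +-commutativeSemigroup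
  using () renaming (interchange to +-interchange)
open import Data.Product using (_,_; proj₁)
open import Data.Product.Properties using (≡-dec)
open import Function using (id; Surjective)
open import Relation.Binary.Definitions using (DecidableEquality)
open import Relation.Binary.PropositionalEquality
open import Relation.Nullary using (¬_; yes; no; ⌊_⌋)

private variable A B : Set

𝟙 : Bool → ℕ
𝟙 b = if b then 1 else 0

∑ : List A → (A → ℕ) → ℕ
∑ xs f = sum (map f xs)

syntax ∑ xs (λ x → e) = ∑[ x ∈ xs ] e

∑-mono-≤ : {f g : A → ℕ} → (∀ x → f x ≤ g x) → (xs : List A) → ∑ xs f ≤ ∑ xs g
∑-mono-≤ f≤g []       = z≤n
∑-mono-≤ f≤g (x ∷ xs) = +-mono-≤ (f≤g x) (∑-mono-≤ f≤g xs)

∑-mono-< : {f g : A → ℕ} → (∀ x → f x < g x) → (x : A) (xs : List A) → ∑ (x ∷ xs) f < ∑ (x ∷ xs) g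
∑-mono-< f<g x xs = +-mono-<-≤ (f<g x) (∑-mono-≤ (λ y → <⇒≤ (f<g y)) xs)

∑-distrib-+ : (f g : A → ℕ) (xs : List A) → ∑[ x ∈ xs ] (f x + g x) ≡ ∑ xs f + ∑ xs g
∑-distrib-+ f g []       = refl
∑-distrib-+ f g (x ∷ xs) =
  trans (cong (f x + g x +_) (∑-distrib-+ f g xs)) (+-interchange (f x) (g x) _ _)

∑-*-distribˡ : (n : ℕ) (f : A → ℕ) (xs : List A) → ∑[ x ∈ xs ] (n * f x) ≡ n * ∑ xs f
∑-*-distribˡ n f []       = sym (*-zeroʳ n)
∑-*-distribˡ n f (x ∷ xs) =
  trans (cong (n * f x +_) (∑-*-distribˡ n f xs)) (sym (*-distribˡ-+ n (f x) _))

∑-const : (c : ℕ) (xs : List A) → ∑[ x ∈ xs ] c ≡ length xs * c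
∑-const c []       = refl
∑-const c (x ∷ xs) = cong (c +_) (∑-const c xs)

∑-comm : (f : A → B → ℕ) (xs : List A) (ys : List B) →
         ∑[ x ∈ xs ] ∑[ y ∈ ys ] f x y ≡ ∑[ y ∈ ys ] ∑[ x ∈ xs ] f x y
∑-comm f []       ys = sym (trans (∑-const 0 ys) (*-zeroʳ (length ys)))
∑-comm f (x ∷ xs) ys =
  trans (cong (∑ ys (f x) +_) (∑-comm f xs ys)) (sym (∑-distrib-+ (f x) _ ys))

length-cartesianProduct : (xs : List A) (ys : List B) →
  length (cartesianProduct xs ys) ≡ length xs * length ys
length-cartesianProduct []       ys = refl
length-cartesianProduct (x ∷ xs) ys =
  trans (length-++ (map (x ,_) ys))
        (cong₂ _+_ (length-map (x ,_) ys) (length-cartesianProduct xs ys))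

module _ (_≟_ : DecidableEquality A) where

  multiplicity : A → List A → ℕ
  multiplicity x xs = ∑[ y ∈ xs ] 𝟙 ⌊ y ≟ x ⌋

  ∈⇒1≤multiplicity : ∀ {x xs} → x ∈ xs → 1 ≤ multiplicity x xs
  ∈⇒1≤multiplicity {x} (here refl) with x ≟ x
  ... | yes _   = s≤s z≤n
  ... | no x≢x  = ⊥-elim (x≢x refl)
  ∈⇒1≤multiplicity {x} {y ∷ _} (there x∈xs) = ≤-trans (∈⇒1≤multiplicity x∈xs) (m≤n+m _ _)

  ∉⇒multiplicity≡0 : ∀ {x xs} → All (x ≢_) xs → multiplicity x xs ≡ 0
  ∉⇒multiplicity≡0 []                       = refl
  ∉⇒multiplicity≡0 {x} (_∷_ {y} x≢y x∉xs) with y ≟ x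
  ... | yes refl = ⊥-elim (x≢y refl)
  ... | no _     = ∉⇒multiplicity≡0 x∉xs

  Unique⇒multiplicity≤1 : ∀ {x xs} → Unique xs → multiplicity x xs ≤ 1
  Unique⇒multiplicity≤1 {x} {[]}     _ = z≤n
  Unique⇒multiplicity≤1 {x} {y ∷ xs} (y∉xs ∷ unique) with y ≟ x
  ... | yes refl rewrite ∉⇒multiplicity≡0 y∉xs = ≤-refl
  ... | no _     = Unique⇒multiplicity≤1 unique

pigeonhole : ∀ {n N} .{{_ : NonZero n}} (f : Fin n → ℕ) →
             (∀ i → n * f i < N) → ∑[ i ∈ allFin n ] f i < N
pigeonhole {suc n} {N} f below = *-cancelˡ-< (suc n) _ _ (begin-strict
  suc n * ∑ (allFin (suc n)) f           ≡⟨ ∑-*-distribˡ (suc n) f (allFin (suc n)) ⟨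
  ∑[ i ∈ allFin (suc n) ] (suc n * f i)  <⟨ ∑-mono-< below Fin.zero (tabulate Fin.suc) ⟩
  ∑[ i ∈ allFin (suc n) ] N              ≡⟨ ∑-const N (allFin (suc n)) ⟩
  length (allFin (suc n)) * N            ≡⟨ cong (_* N) (length-tabulate {n = suc n} id) ⟩
  suc n * N                              ∎)
  where open ≤-Reasoning

length-allV : (k ℓ : ℕ) → length (allV k ℓ) ≡ k * ℓ
length-allV k ℓ = trans (length-cartesianProduct (allFin k) (allFin ℓ))
                        (cong₂ _*_ (length-tabulate {n = k} id) (length-tabulate {n = ℓ} id))

_≟ᵥ_ : {k ℓ : ℕ} → DecidableEquality (V k ℓ)
_≟ᵥ_ = ≡-dec _≟ᶠ_ _≟ᶠ_

module _ {k ℓ m : ℕ} (H : Realization k ℓ) (c : V k ℓ → Fin m) where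

  classSize : Fin m → ℕ
  classSize i = ∑[ u ∈ allV k ℓ ] 𝟙 ⌊ i ≟ᶠ c u ⌋

  ∑-classSize : k * ℓ ≤ ∑[ i ∈ allFin m ] classSize i
  ∑-classSize = begin
    k * ℓ                                                 ≡⟨ trans (*-identityʳ _) (length-allV k ℓ) ⟨
    length (allV k ℓ) * 1                                 ≡⟨ ∑-const 1 (allV k ℓ) ⟨
    ∑[ u ∈ allV k ℓ ] 1                                   ≤⟨ ∑-mono-≤ (λ u → ∈⇒1≤multiplicity _≟ᶠ_ (∈-allFin (c u))) (allV k ℓ) ⟩
    ∑[ u ∈ allV k ℓ ] multiplicity _≟ᶠ_ (c u) (allFin m)  ≡⟨ ∑-comm _ (allFin m) (allV k ℓ) ⟨
    ∑[ i ∈ allFin m ] classSize i                         ∎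
    where open ≤-Reasoning

  module _ (clique : ∀ u v → c u ≡ c v → u ≢ v → adj H u v ≡ true) where

    sameClass≤adjacent+self : ∀ v u → 𝟙 ⌊ c v ≟ᶠ c u ⌋ ≤ 𝟙 (adj H v u) + 𝟙 ⌊ u ≟ᵥ v ⌋
    sameClass≤adjacent+self v u with u ≟ᵥ v | c v ≟ᶠ c u
    ... | yes refl | yes _     = m≤n+m 1 (𝟙 (adj H v v))
    ... | no u≢v   | yes cv≡cu rewrite clique v u cv≡cu (≢-sym u≢v) = s≤s z≤n
    ... | _        | no _      = z≤n

    classSize≤degree+1 : ∀ v → classSize (c v) ≤ degree H v + 1
    classSize≤degree+1 v = begin
      classSize (c v)                                    ≤⟨ ∑-mono-≤ (sameClass≤adjacent+self v) (allV k ℓ) ⟩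
      ∑[ u ∈ allV k ℓ ] (𝟙 (adj H v u) + 𝟙 ⌊ u ≟ᵥ v ⌋)  ≡⟨ ∑-distrib-+ _ _ (allV k ℓ) ⟩
      degree H v + multiplicity _≟ᵥ_ v (allV k ℓ)        ≤⟨ +-monoʳ-≤ (degree H v) (Unique⇒multiplicity≤1 _≟ᵥ_ allV-unique) ⟩
      degree H v + 1                                     ∎
      where
      open ≤-Reasoning
      allV-unique : Unique (allV k ℓ)
      allV-unique = cartesianProduct⁺ (allFin⁺ k) (allFin⁺ ℓ)

    classSize<average : m < k → (∀ v → (degree H v + 1) * (k ∸ 1) < k * ℓ) →
                        ∀ v → m * classSize (c v) < k * ℓ
    classSize<average m<k Δ-bound v = begin-strict
      m * classSize (c v)         ≤⟨ *-mono-≤ (∸-monoˡ-≤ 1 m<k) (classSize≤degree+1 v) ⟩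
      (k ∸ 1) * (degree H v + 1)  ≡⟨ *-comm (k ∸ 1) _ ⟩
      (degree H v + 1) * (k ∸ 1)  <⟨ Δ-bound v ⟩
      k * ℓ                       ∎
      where open ≤-Reasoning

lemma2p3 : (k ℓ : ℕ) → 2 ≤ k → 1 ≤ ℓ → (H : Realization k ℓ) →
    -- Δ(H) < kℓ/(k-1) - 1, i.e. (deg v + 1)(k - 1) < kℓ for every vertex v
    (∀ v → (degree H v + 1) * (k ∸ 1) < k * ℓ) →
    CliqueCoverNumber≡ H k
lemma2p3 k ℓ 2≤k 1≤ℓ H Δ-bound = (proj₁ , partsSurjective , adj-part H) , noSmallerCover
  where
  partsSurjective : Surjective _≡_ _≡_ proj₁
  partsSurjective i = (i , fromℕ< 1≤ℓ) , cong proj₁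

  noSmallerCover : ∀ m → m < k → ¬ HasCliqueCover H m
  noSmallerCover zero    _   (c , _) = ¬Fin0 (c (fromℕ< (<⇒≤ 2≤k) , fromℕ< 1≤ℓ))
  noSmallerCover (suc m) m<k (c , surjective , clique) =
    <⇒≱ (pigeonhole (classSize H c) everyClassSmall) (∑-classSize H c)
    where
    everyClassSmall : ∀ i → suc m * classSize H c i < k * ℓ
    everyClassSmall i with (v , hit) ← surjective i =
      subst (λ j → suc m * classSize H c j < k * ℓ) (hit refl)
            (classSize<average H c clique m<k Δ-bound v)
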